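{- Let $q\subseteq\{1,\dots,n\}$ be a queue and $u\in\mathcal W_n$. The word $q(u)$ produced by the algorithm below does not depend on the choice of the permutation $(i_1,\dots,i_n)$, as long as $u_{i_1}\le u_{i_2}\le\cdots\le u_{i_n}$.
   Context: Fix $n\ge1$; sites $1,\dots,n$ are arranged cyclically (the site after $n$ is $1$). $\mathcal{W}_n$ is the set of words $u=u_1\cdots u_n$ with letters in $\{1,2,\dots\}$. Algorithm computing $v=q(u)$: choose a permutation $(i_1,\dots,i_n)$ of $(1,\dots,n)$ with $u_{i_1}\le\cdots\le u_{i_n}$; initially no letter of $v$ is set. Phase I: for $i=i_n,i_{n-1},\dots,i_{|q|+1}$ in this order, find the first site $j$ weakly to the left of $i$ (cyclically) such that $j\notin q$ and $v_j$ is not set, and set $v_j=u_i+1$. Phase II: for $i=i_1,\dots,i_{|q|}$ in this order, find the first site $j$ weakly to the right of $i$ (cyclically) such that $j\in q$ and $v_j$ is not set, and set $v_j=u_i$. -}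

module Defs where

open import Data.Nat using (ℕ; zero; suc; _+_; _∸_; _≤_; _<?_; _≤?_; NonZero)
open import Data.Nat.DivMod using (_mod_)
open import Data.Fin using (Fin; toℕ; _≟_)
open import Data.Fin.Subset using (Subset; ∣_∣)
open import Data.Fin.Permutation using (Permutation′; _⟨$⟩ʳ_)
open import Data.Vec using (lookup)
open import Data.Bool using (Bool; true; false; not; _∧_; if_then_else_)
open import Data.Maybe using (Maybe; just; nothing; is-nothing)
open import Data.List using (List; []; _∷_; map; upTo; filter; reverse; foldl; allFin)
open import Relation.Nullary.Decidable using (does; ¬?)

-- Words in 𝒲_n: letters indexed by the sites (Fin n, site 1 = index 0).
Word : ℕ → Set
Word n = Fin n → ℕ

Partial : ℕ → Set
Partial n = Fin n → Maybe ℕ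

module _ {n : ℕ} .{{_ : NonZero n}} where

  stepLeft : Fin n → ℕ → Fin n
  stepLeft i t = ((toℕ i + n) ∸ t) mod n

  stepRight : Fin n → ℕ → Fin n
  stepRight i t = (toℕ i + t) mod n

firstSuch : {A : Set} → (A → Bool) → List A → Maybe A
firstSuch p [] = nothing
firstSuch p (x ∷ xs) = if p x then just x else firstSuch p xs

setAt : {n : ℕ} → Partial n → Fin n → ℕ → Partial n
setAt v j x j' = if does (j' ≟ j) then just x else v j'

module _ {n : ℕ} .{{_ : NonZero n}} (q : Subset n) (u : Word n) where

  phaseIStep : Partial n → Fin n → Partial n
  phaseIStep v i with firstSuch (λ j → not (lookup q j) ∧ is-nothing (v j))
                                (map (stepLeft i) (upTo n))
  ... | just j  = setAt v j (suc (u i))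
  ... | nothing = v

  phaseIIStep : Partial n → Fin n → Partial n
  phaseIIStep v i with firstSuch (λ j → lookup q j ∧ is-nothing (v j))
                                 (map (stepRight i) (upTo n))
  ... | just j  = setAt v j (u i)
  ... | nothing = v

  -- The algorithm with the permutation (i_1,…,i_n) given by σ:
  -- i_{k+1} = σ ⟨$⟩ʳ k for k : Fin n (0-based).
  -- Phase I processes k = n-1, …, |q| (i.e. i_n, …, i_{|q|+1});
  -- Phase II processes k = 0, …, |q|-1 (i.e. i_1, …, i_{|q|}).
  queueAlg : Permutation′ n → Partial n
  queueAlg σ =
    foldl (λ v k → phaseIIStep v (σ ⟨$⟩ʳ k))
      (foldl (λ v k → phaseIStep v (σ ⟨$⟩ʳ k))
             (λ _ → nothing)
             (reverse (filter (λ k → ∣ q ∣ ≤? toℕ k) (allFin n))))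
      (filter (λ k → toℕ k <? ∣ q ∣) (allFin n))

SortsWord : {n : ℕ} → Word n → Permutation′ n → Set
SortsWord u σ = ∀ k l → toℕ k ≤ toℕ l → u (σ ⟨$⟩ʳ k) ≤ u (σ ⟨$⟩ʳ l)

module Submission where

open import Defs
open import Data.Bool using (Bool; true; false; not; _∧_; if_then_else_)
open import Data.Bool.Properties using (∧-zeroʳ; ∧-identityʳ)
open import Data.Empty using (⊥-elim)
open import Data.Fin using (Fin; toℕ; _≟_)
open import Data.Fin.Permutation using (Permutation′; _⟨$⟩ʳ_; _⟨$⟩ˡ_; inverseˡ; inverseʳ)
open import Data.Fin.Properties using (toℕ-fromℕ<; toℕ-injective; toℕ<n)
open import Data.Fin.Subset using (Subset; ∣_∣; ∁)
open import Data.Fin.Subset.Properties using (∣p∣≤n; ∣∁p∣≡n∸∣p∣)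
open import Data.List using (List; []; _∷_; _++_; map; filter; foldl; reverse; length; iterate; applyUpTo; upTo; allFin; tabulate)
open import Data.List.Membership.Propositional using (_∈_; _∉_)
open import Data.List.Membership.Propositional.Properties using (∈-++⁺ˡ; ∈-∃++; ∈-allFin; ∈-map⁺; ∈-upTo⁺)
open import Data.List.Membership.Propositional.Properties.WithK using (unique∧set⇒bag)
open import Data.List.Properties
  using (∷-injective; ∷-injectiveˡ; length-++; length-iterate; length-map; length-reverse; length-tabulate;
         map-++; map-applyUpTo; map-tabulate; reverse-++; reverse-map; unfold-reverse; foldl-cong; foldl-map;
         filter-accept; filter-reject; filter-none; filter-all)
open import Data.List.Relation.Binary.BagAndSetEquality using (∼bag⇒↭)
open import Data.List.Relation.Binary.Permutation.Propositional using (_↭_; ↭-sym; ↭-trans)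
open import Data.List.Relation.Binary.Permutation.Propositional.Properties using (∈-resp-↭; ↭-empty-inv; drop-mid; ↭-reverse)
open import Data.List.Relation.Unary.All as All using (All; []; _∷_)
import Data.List.Relation.Unary.All.Properties as All
open import Data.List.Relation.Unary.AllPairs using (AllPairs; []; _∷_)
import Data.List.Relation.Unary.AllPairs.Properties as AllPairs
open import Data.List.Relation.Unary.Any using (here; there)
open import Data.List.Relation.Unary.Unique.Propositional using (Unique)
import Data.List.Relation.Unary.Unique.Propositional.Properties as Unique
open import Data.Maybe using (Maybe; just; nothing; is-nothing)
open import Data.Nat using (ℕ; zero; suc; _+_; _∸_; _*_; _/_; _%_; _≤_; _<_; _<ᵇ_; _≤?_; _<?_; s≤s; z<s; NonZero; >-nonZero⁻¹)
open import Data.Nat.DivMod using (_mod_; m%n<n; m%n%n≡m%n; %-distribˡ-+; [m+n]%n≡m%n; [m+kn]%n≡m%n; m<n⇒m%n≡m; m≡m%n+[m/n]*n)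
open import Data.Nat.GeneralisedArithmetic using () renaming (iterate to iter)
open import Data.Nat.Properties
  using (suc-injective; +-suc; +-assoc; +-comm; +-identityʳ; +-∸-assoc; m+n∸m≡n; m+n∸n≡m; m+[n∸m]≡n; m∸n+n≡m;
         m≤m+n; m≤n+m; ≤-trans; ≤-antisym; <⇒≤; <-trans; <⇒≱; ≮⇒≥)
open import Data.Product using (∃₂; _×_; _,_)
open import Data.Vec using ([]; _∷_; lookup)
open import Data.Vec.Properties using (lookup-map)
open import Function using (_∘_; flip)
open import Function.Bundles using (mk⇔)
open import Relation.Binary.Bundles using (Setoid)
open import Relation.Binary.Core using (Rel)
open import Relation.Binary.PropositionalEquality
  using (_≡_; _≢_; _≗_; refl; sym; trans; cong; cong₂; cong-app; subst; _→-setoid_; module ≡-Reasoning)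
open import Relation.Nullary using (yes; no; does; ¬_)
open import Relation.Unary using (Pred; Decidable)

-- Both phases are instances of one operation: scan cyclically from a site i (leftwards
-- in Phase I, rightwards in Phase II) and write a value into the first eligible site that
-- is still unset. Two such operations writing the same value commute: if they reach
-- different sites this is clear; if they reach the same site j, the second one continues
-- its scan past j, and by cyclicity this is the same as scanning from j, wherever it
-- started. Hence a phase is unchanged when sites carrying equal letters are processed in
-- another order. The permutations σ and τ may split a block of equal letters differently
-- between the two phases; but Phase I makes n − |q| steps, each filling one of the n − |q|
-- sites outside q, so further Phase I steps would change nothing, and likewise Phase II
-- fills the |q| sites of q in |q| steps. So each phase may be run over all n sites, and
-- then σ and τ feed it the same sites in two orders differing only within blocks of
-- equal letters.

module _ {A : Set} where

  Fails : (A → Bool) → List A → Set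
  Fails p = All (λ x → p x ≡ false)

  firstSuch-cong : ∀ {p p′ : A → Bool} → p ≗ p′ → firstSuch p ≗ firstSuch p′
  firstSuch-cong p≗p′ []       = refl
  firstSuch-cong {p} {p′} p≗p′ (x ∷ xs) rewrite p≗p′ x with p′ x
  ... | true  = refl
  ... | false = firstSuch-cong p≗p′ xs

  firstSuch-just⇒true : ∀ {p : A → Bool} xs {j} → firstSuch p xs ≡ just j → p j ≡ true
  firstSuch-just⇒true {p} (x ∷ xs) eq with p x in px
  firstSuch-just⇒true {p} (x ∷ xs) refl | true  = px
  ...                                    | false = firstSuch-just⇒true xs eq

  firstSuch-nothing⇒false : ∀ {p : A → Bool} {xs x} → firstSuch p xs ≡ nothing → x ∈ xs → p x ≡ false
  firstSuch-nothing⇒false {p} {y ∷ xs} eq x∈ with p y in py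
  firstSuch-nothing⇒false {p} {y ∷ xs} () x∈          | true
  firstSuch-nothing⇒false {p} {y ∷ xs} eq (here refl) | false = py
  firstSuch-nothing⇒false {p} {y ∷ xs} eq (there x∈)  | false = firstSuch-nothing⇒false eq x∈

  firstSuch-split : ∀ {p : A → Bool} xs {j} → firstSuch p xs ≡ just j →
                    ∃₂ λ ys zs → xs ≡ ys ++ j ∷ zs × Fails p ys
  firstSuch-split {p} (x ∷ xs) eq with p x in px
  firstSuch-split {p} (x ∷ xs) refl | true = [] , xs , refl , []
  ... | false with ys , zs , refl , fails ← firstSuch-split xs eq = x ∷ ys , zs , refl , px ∷ fails

  firstSuch-fails : ∀ {p : A → Bool} {xs} → Fails p xs → firstSuch p xs ≡ nothing
  firstSuch-fails []                 = refl
  firstSuch-fails (px≡false ∷ fails) rewrite px≡false = firstSuch-fails fails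

  firstSuch-++-skip : ∀ {p : A → Bool} {ys} → Fails p ys → ∀ zs → firstSuch p (ys ++ zs) ≡ firstSuch p zs
  firstSuch-++-skip []                 zs = refl
  firstSuch-++-skip (px≡false ∷ fails) zs rewrite px≡false = firstSuch-++-skip fails zs

  firstSuch-++-fails : ∀ {p : A → Bool} xs {ys} → Fails p ys → firstSuch p (xs ++ ys) ≡ firstSuch p xs
  firstSuch-++-fails []       fails = firstSuch-fails fails
  firstSuch-++-fails {p} (x ∷ xs) fails with p x
  ... | true  = refl
  ... | false = firstSuch-++-fails xs fails

  firstSuch-restrict : ∀ {p p′ : A → Bool} xs {j} → firstSuch p xs ≡ just j →
                       (∀ {x} → p x ≡ false → p′ x ≡ false) → p′ j ≡ true → firstSuch p′ xs ≡ just j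
  firstSuch-restrict {p′ = p′} xs {j} eq p′⊆p p′j with ys , zs , refl , fails ← firstSuch-split xs eq
    rewrite firstSuch-++-skip (All.map p′⊆p fails) (j ∷ zs) | p′j = refl

countᵇ : ∀ {A : Set} → (A → Bool) → List A → ℕ
countᵇ p []       = 0
countᵇ p (x ∷ xs) = if p x then suc (countᵇ p xs) else countᵇ p xs

module _ {A : Set} where

  countᵇ-cong : ∀ {p p′ : A → Bool} → p ≗ p′ → countᵇ p ≗ countᵇ p′
  countᵇ-cong p≗p′ []       = refl
  countᵇ-cong p≗p′ (x ∷ xs) rewrite p≗p′ x | countᵇ-cong p≗p′ xs = refl

  countᵇ-fails : ∀ {p : A → Bool} {xs} → Fails p xs → countᵇ p xs ≡ 0
  countᵇ-fails []                 = refl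
  countᵇ-fails (px≡false ∷ fails) rewrite px≡false = countᵇ-fails fails

countᵇ-map : ∀ {A B : Set} (p : B → Bool) (f : A → B) xs → countᵇ p (map f xs) ≡ countᵇ (p ∘ f) xs
countᵇ-map p f []       = refl
countᵇ-map p f (x ∷ xs) rewrite countᵇ-map p f xs = refl

countᵇ-tabulate : ∀ {A : Set} {n} (p : A → Bool) (f : Fin n → A) → countᵇ p (tabulate f) ≡ countᵇ (p ∘ f) (allFin n)
countᵇ-tabulate p f = trans (cong (countᵇ p) (sym (map-tabulate (λ k → k) f))) (countᵇ-map p f (allFin _))

module _ {A : Set} where

  module _ {ℓ} {P : Pred A ℓ} (P? : Decidable P) where

    length-filter≡countᵇ : ∀ xs → length (filter P? xs) ≡ countᵇ (does ∘ P?) xs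
    length-filter≡countᵇ []       = refl
    length-filter≡countᵇ (x ∷ xs) with does (P? x)
    ... | true  = cong suc (length-filter≡countᵇ xs)
    ... | false = length-filter≡countᵇ xs

    filter-++-filter : ∀ {ℓ′} {Q : Pred A ℓ′} (Q? : Decidable Q) → (∀ {x} → P x → ¬ Q x) → (∀ {x} → ¬ P x → Q x) →
                       ∀ {xs} → AllPairs (λ x y → P y → P x) xs → filter P? xs ++ filter Q? xs ≡ xs
    filter-++-filter Q? P⇒¬Q ¬P⇒Q {[]}     []             = refl
    filter-++-filter Q? P⇒¬Q ¬P⇒Q {x ∷ xs} (x~xs ∷ sorted) with P? x
    ... | yes px rewrite filter-reject Q? {x} {xs} (P⇒¬Q px) = cong (x ∷_) (filter-++-filter Q? P⇒¬Q ¬P⇒Q sorted)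
    ... | no ¬px rewrite filter-accept Q? {x} {xs} (¬P⇒Q ¬px) =
      trans (cong (_++ x ∷ filter Q? xs) (filter-none P? rest-fails)) (cong (x ∷_) (filter-all Q? (All.map ¬P⇒Q rest-fails)))
      where
        rest-fails : All (¬_ ∘ P) xs
        rest-fails = All.map (λ Py⇒Px Py → ¬px (Py⇒Px Py)) x~xs

  unique-↭ : ∀ {xs ys : List A} → Unique xs → Unique ys →
             (∀ {x} → x ∈ xs → x ∈ ys) → (∀ {x} → x ∈ ys → x ∈ xs) → xs ↭ ys
  unique-↭ xs-unique ys-unique xs⊆ys ys⊆xs = ∼bag⇒↭ (unique∧set⇒bag xs-unique ys-unique (mk⇔ xs⊆ys ys⊆xs))

module _ {a r} {A : Set a} {R : Rel A r} where

  AllPairs-++-∷⁻ : ∀ ys {x zs} → AllPairs R (ys ++ x ∷ zs) → AllPairs R (ys ++ zs) × All (λ y → R y x) ys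
  AllPairs-++-∷⁻ []       (_ ∷ sorted)  = sorted , []
  AllPairs-++-∷⁻ (y ∷ ys) (y~ ∷ sorted) with sorted′ , ys~x ← AllPairs-++-∷⁻ ys sorted
                                        with y~ys , y~x ∷ y~zs ← All.++⁻ ys y~ =
    All.++⁺ y~ys y~zs ∷ sorted′ , y~x ∷ ys~x

  AllPairs-reverse : ∀ {xs} → AllPairs R xs → AllPairs (flip R) (reverse xs)
  AllPairs-reverse {[]}     []            = []
  AllPairs-reverse {x ∷ xs} (x~ ∷ sorted) = subst (AllPairs (flip R)) (sym (unfold-reverse x xs))
    (AllPairs.++⁺ (AllPairs-reverse sorted) ([] ∷ [])
      (All.tabulate (λ y∈ → All.lookup x~ (∈-resp-↭ (↭-reverse xs) y∈) ∷ [])))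

module _ {c ℓ x} (S : Setoid c ℓ) {X : Set x} where

  open Setoid S using (_≈_) renaming (Carrier to C; refl to ≈-refl; sym to ≈-sym; trans to ≈-trans)

  module _ (step : C → X → C) (step-cong : ∀ {v w} y → v ≈ w → step v y ≈ step w y) where

    foldl-congˡ : ∀ ys {v w} → v ≈ w → foldl step v ys ≈ foldl step w ys
    foldl-congˡ []       v≈w = v≈w
    foldl-congˡ (y ∷ ys) v≈w = foldl-congˡ ys (step-cong y v≈w)

    module _ {r} {R : Rel X r} (step-swap : ∀ {y z} → R y z → R z y → ∀ v → step (step v y) z ≈ step (step v z) y) where

      foldl-bubble : ∀ ys {y zs v} → All (λ z → R z y × R y z) ys →
                     foldl step v (ys ++ y ∷ zs) ≈ foldl step v (y ∷ ys ++ zs)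
      foldl-bubble []                 []                   = ≈-refl
      foldl-bubble (z ∷ ys) {v = v} ((z~y , y~z) ∷ ties) =
        ≈-trans (foldl-bubble ys ties) (foldl-congˡ (ys ++ _) (step-swap z~y y~z v))

      foldl-↭-sorted : ∀ {ys zs} v → ys ↭ zs → AllPairs R ys → AllPairs R zs → foldl step v ys ≈ foldl step v zs
      foldl-↭-sorted {[]}     v ys↭zs _ _ with refl ← ↭-empty-inv (↭-sym ys↭zs) = ≈-refl
      foldl-↭-sorted {y ∷ ys} v ys↭zs (y~ys ∷ ys-sorted) zs-sorted
        with zs₁ , zs₂ , refl ← ∈-∃++ (∈-resp-↭ ys↭zs (here refl))
        with zs-sorted′ , zs₁~y ← AllPairs-++-∷⁻ zs₁ zs-sorted =
        ≈-trans (foldl-↭-sorted (step v y) ys↭zs′ ys-sorted zs-sorted′) (≈-sym (foldl-bubble zs₁ ties))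
        where
          ys↭zs′ : ys ↭ zs₁ ++ zs₂
          ys↭zs′ = drop-mid [] zs₁ ys↭zs
          ties : All (λ z → R z y × R y z) zs₁
          ties = All.tabulate (λ z∈ → All.lookup zs₁~y z∈ , All.lookup y~ys (∈-resp-↭ (↭-sym ys↭zs′) (∈-++⁺ˡ z∈)))

module _ {A : Set} (f : A → A) where

  iter-+ : ∀ a k m → iter f a (k + m) ≡ iter f (iter f a k) m
  iter-+ a zero    m = refl
  iter-+ a (suc k) m = iter-+ (f a) k m

  iterate-+ : ∀ a k m → iterate f a (k + m) ≡ iterate f a k ++ iterate f (iter f a k) m
  iterate-+ a zero    m = refl
  iterate-+ a (suc k) m = cong (a ∷_) (iterate-+ (f a) k m)

  iterate-split : ∀ xs {ys a m} → iterate f a m ≡ xs ++ ys →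
                  iterate f a (length xs) ≡ xs × iterate f (iter f a (length xs)) (m ∸ length xs) ≡ ys
  iterate-split []       eq = refl , eq
  iterate-split (x ∷ xs) {m = suc m} eq with refl , eq′ ← ∷-injective eq
                                        with prefix , suffix ← iterate-split xs eq′ = cong (x ∷_) prefix , suffix

  iterate-rotate : ∀ {a m} xs {ys} → iter f a m ≡ a → iterate f a m ≡ xs ++ ys →
                   iterate f (iter f a (length xs)) m ≡ ys ++ xs
  iterate-rotate {a} {m} xs {ys} period eq with prefix , suffix ← iterate-split xs eq = begin
    iterate f b m                                            ≡⟨ cong (iterate f b) (m∸n+n≡m k≤m) ⟨
    iterate f b ((m ∸ k) + k)                                ≡⟨ iterate-+ b (m ∸ k) k ⟩
    iterate f b (m ∸ k) ++ iterate f (iter f b (m ∸ k)) k    ≡⟨ cong (λ c → iterate f b (m ∸ k) ++ iterate f c k) wraps ⟩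
    iterate f b (m ∸ k) ++ iterate f a k                     ≡⟨ cong₂ _++_ suffix prefix ⟩
    ys ++ xs                                                 ∎
    where
      open ≡-Reasoning
      k : ℕ
      k = length xs
      b : A
      b = iter f a k
      k≤m : k ≤ m
      k≤m = subst (k ≤_) (trans (sym (length-++ xs)) (trans (cong length (sym eq)) (length-iterate f a m))) (m≤m+n k _)
      wraps : iter f b (m ∸ k) ≡ a
      wraps = trans (sym (iter-+ a k (m ∸ k))) (trans (cong (iter f a) (m+[n∸m]≡n k≤m)) period)

  iterate-head : ∀ {a m x xs} → iterate f a m ≡ x ∷ xs → a ≡ x
  iterate-head {m = suc m} eq = ∷-injectiveˡ eq

  iterate-rotate-at : ∀ {a m} xs {j ys} → iter f a m ≡ a → iterate f a m ≡ xs ++ j ∷ ys →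
                      iterate f j m ≡ j ∷ ys ++ xs
  iterate-rotate-at {a} {m} xs {j} {ys} period eq =
    subst (λ b → iterate f b m ≡ j ∷ ys ++ xs) (iterate-head rotated) rotated
    where
      rotated : iterate f (iter f a (length xs)) m ≡ (j ∷ ys) ++ xs
      rotated = iterate-rotate xs period eq

  applyUpTo-orbit : ∀ {h : ℕ → A} m → (∀ t → t < m → h (suc t) ≡ f (h t)) → applyUpTo h m ≡ iterate f (h 0) m
  applyUpTo-orbit         zero    step = refl
  applyUpTo-orbit {h = h} (suc m) step = cong (h 0 ∷_) (begin
    applyUpTo (h ∘ suc) m  ≡⟨ applyUpTo-orbit m (λ t t<m → step (suc t) (s≤s t<m)) ⟩
    iterate f (h 1) m      ≡⟨ cong (λ x → iterate f x m) (step 0 z<s) ⟩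
    iterate f (f (h 0)) m  ∎)
    where open ≡-Reasoning

  iter-orbit : ∀ {h : ℕ → A} m → (∀ t → t < m → h (suc t) ≡ f (h t)) → iter f (h 0) m ≡ h m
  iter-orbit         zero    step = refl
  iter-orbit {h = h} (suc m) step = begin
    iter f (f (h 0)) m  ≡⟨ cong (λ x → iter f x m) (step 0 z<s) ⟨
    iter f (h 1) m      ≡⟨ iter-orbit m (λ t t<m → step (suc t) (s≤s t<m)) ⟩
    h (suc m)           ∎
    where open ≡-Reasoning

record CyclicScan (n : ℕ) : Set where
  field
    scan          : Fin n → List (Fin n)
    scan-complete : ∀ i j → j ∈ scan i
    scan-rotate   : ∀ i {xs j ys} → scan i ≡ xs ++ j ∷ ys → scan j ≡ j ∷ ys ++ xs

stepScan : ∀ {n} (step : Fin n → ℕ → Fin n) →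
           (∀ i → step i 0 ≡ i) → (∀ i → step i n ≡ i) → (∀ i t → t < n → step (step i t) 1 ≡ step i (suc t)) →
           (∀ i j → j ∈ map (step i) (upTo n)) → CyclicScan n
stepScan {n} step step-zero step-period step-suc complete = record
  { scan          = λ i → map (step i) (upTo n)
  ; scan-complete = complete
  ; scan-rotate   = λ i {xs} eq → trans (scan-orbit _) (iterate-rotate-at next xs (period i) (trans (sym (scan-orbit i)) eq))
  }
  where
    next : Fin n → Fin n
    next j = step j 1
    orbit : ∀ i t → t < n → step i (suc t) ≡ next (step i t)
    orbit i t t<n = sym (step-suc i t t<n)
    scan-orbit : ∀ i → map (step i) (upTo n) ≡ iterate next i n
    scan-orbit i = begin
      map (step i) (upTo n)         ≡⟨ map-applyUpTo (λ t → t) (step i) n ⟩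
      applyUpTo (step i) n          ≡⟨ applyUpTo-orbit next n (orbit i) ⟩
      iterate next (step i 0) n     ≡⟨ cong (λ j → iterate next j n) (step-zero i) ⟩
      iterate next i n              ∎
      where open ≡-Reasoning
    period : ∀ i → iter next i n ≡ i
    period i = begin
      iter next i n           ≡⟨ cong (λ j → iter next j n) (step-zero i) ⟨
      iter next (step i 0) n  ≡⟨ iter-orbit next n (orbit i) ⟩
      step i n                ≡⟨ step-period i ⟩
      i                       ∎
      where open ≡-Reasoning

[m%n+k]%n≡[m+k]%n : ∀ m k n .{{_ : NonZero n}} → (m % n + k) % n ≡ (m + k) % n
[m%n+k]%n≡[m+k]%n m k n = begin
  (m % n + k) % n           ≡⟨ %-distribˡ-+ (m % n) k n ⟩
  (m % n % n + k % n) % n   ≡⟨ cong (λ r → (r + k % n) % n) (m%n%n≡m%n m n) ⟩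
  (m % n + k % n) % n       ≡⟨ %-distribˡ-+ m k n ⟨
  (m + k) % n               ∎
  where open ≡-Reasoning

[a+n∸t]+[n∸1]≡[a+n∸[1+t]]+n : ∀ a n t → t < n → (a + n ∸ t) + (n ∸ 1) ≡ (a + n ∸ suc t) + n
[a+n∸t]+[n∸1]≡[a+n∸[1+t]]+n a (suc n) t (s≤s t≤n) = begin
  (a + suc n ∸ t) + n          ≡⟨ cong (λ m → m ∸ t + n) (+-suc a n) ⟩
  (suc (a + n) ∸ t) + n        ≡⟨ cong (_+ n) (+-∸-assoc 1 (≤-trans t≤n (m≤n+m n a))) ⟩
  suc (a + n ∸ t) + n          ≡⟨ +-suc (a + n ∸ t) n ⟨
  (a + n ∸ t) + suc n          ≡⟨ cong (λ m → m ∸ suc t + suc n) (+-suc a n) ⟨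
  (a + suc n ∸ suc t) + suc n  ∎
  where open ≡-Reasoning

module _ {n : ℕ} .{{_ : NonZero n}} where

  toℕ-mod : ∀ m → toℕ (m mod n) ≡ m % n
  toℕ-mod m = toℕ-fromℕ< (m%n<n m n)

  %≡toℕ⇒mod≡ : ∀ {m} {j : Fin n} → m % n ≡ toℕ j → m mod n ≡ j
  %≡toℕ⇒mod≡ {m} eq = toℕ-injective (trans (toℕ-mod m) eq)

  stepRight-zero : ∀ i → stepRight i 0 ≡ i
  stepRight-zero i = %≡toℕ⇒mod≡ (trans (cong (_% n) (+-identityʳ (toℕ i))) (m<n⇒m%n≡m (toℕ<n i)))

  stepRight-period : ∀ i → stepRight i n ≡ i
  stepRight-period i = %≡toℕ⇒mod≡ (trans ([m+n]%n≡m%n (toℕ i) n) (m<n⇒m%n≡m (toℕ<n i)))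

  stepRight-suc : ∀ i t → stepRight (stepRight i t) 1 ≡ stepRight i (suc t)
  stepRight-suc i t = toℕ-injective (begin
    toℕ (stepRight (stepRight i t) 1)   ≡⟨ toℕ-mod _ ⟩
    (toℕ (stepRight i t) + 1) % n       ≡⟨ cong (λ m → (m + 1) % n) (toℕ-mod _) ⟩
    ((toℕ i + t) % n + 1) % n           ≡⟨ [m%n+k]%n≡[m+k]%n (toℕ i + t) 1 n ⟩
    (toℕ i + t + 1) % n                 ≡⟨ cong (_% n) (trans (+-assoc (toℕ i) t 1) (cong (toℕ i +_) (+-comm t 1))) ⟩
    (toℕ i + suc t) % n                 ≡⟨ toℕ-mod _ ⟨
    toℕ (stepRight i (suc t))           ∎)
    where open ≡-Reasoning

  stepRight-complete : ∀ i j → j ∈ map (stepRight i) (upTo n)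
  stepRight-complete i j = subst (_∈ map (stepRight i) (upTo n)) reaches (∈-map⁺ (stepRight i) (∈-upTo⁺ (m%n<n d n)))
    where
      d = toℕ j + n ∸ toℕ i
      reaches : stepRight i (d % n) ≡ j
      reaches = %≡toℕ⇒mod≡ (begin
        (toℕ i + d % n) % n   ≡⟨ cong (_% n) (+-comm (toℕ i) (d % n)) ⟩
        (d % n + toℕ i) % n   ≡⟨ [m%n+k]%n≡[m+k]%n d (toℕ i) n ⟩
        (d + toℕ i) % n       ≡⟨ cong (_% n) (m∸n+n≡m (≤-trans (<⇒≤ (toℕ<n i)) (m≤n+m n (toℕ j)))) ⟩
        (toℕ j + n) % n       ≡⟨ [m+n]%n≡m%n (toℕ j) n ⟩
        toℕ j % n             ≡⟨ m<n⇒m%n≡m (toℕ<n j) ⟩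
        toℕ j                 ∎)
        where open ≡-Reasoning

  stepLeft-zero : ∀ i → stepLeft i 0 ≡ i
  stepLeft-zero i = %≡toℕ⇒mod≡ (trans ([m+n]%n≡m%n (toℕ i) n) (m<n⇒m%n≡m (toℕ<n i)))

  stepLeft-period : ∀ i → stepLeft i n ≡ i
  stepLeft-period i = %≡toℕ⇒mod≡ (trans (cong (_% n) (m+n∸n≡m (toℕ i) n)) (m<n⇒m%n≡m (toℕ<n i)))

  stepLeft-suc : ∀ i t → t < n → stepLeft (stepLeft i t) 1 ≡ stepLeft i (suc t)
  stepLeft-suc i t t<n = toℕ-injective (begin
    toℕ (stepLeft (stepLeft i t) 1)         ≡⟨ toℕ-mod _ ⟩
    (toℕ (stepLeft i t) + n ∸ 1) % n        ≡⟨ cong (λ m → (m + n ∸ 1) % n) (toℕ-mod _) ⟩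
    ((toℕ i + n ∸ t) % n + n ∸ 1) % n       ≡⟨ cong (_% n) (+-∸-assoc ((toℕ i + n ∸ t) % n) {n} {1} (>-nonZero⁻¹ n)) ⟩
    ((toℕ i + n ∸ t) % n + (n ∸ 1)) % n     ≡⟨ [m%n+k]%n≡[m+k]%n (toℕ i + n ∸ t) (n ∸ 1) n ⟩
    ((toℕ i + n ∸ t) + (n ∸ 1)) % n         ≡⟨ cong (_% n) ([a+n∸t]+[n∸1]≡[a+n∸[1+t]]+n (toℕ i) n t t<n) ⟩
    ((toℕ i + n ∸ suc t) + n) % n           ≡⟨ [m+n]%n≡m%n (toℕ i + n ∸ suc t) n ⟩
    (toℕ i + n ∸ suc t) % n                 ≡⟨ toℕ-mod _ ⟨
    toℕ (stepLeft i (suc t))                ∎)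
    where open ≡-Reasoning

  stepLeft-complete : ∀ i j → j ∈ map (stepLeft i) (upTo n)
  stepLeft-complete i j = subst (_∈ map (stepLeft i) (upTo n)) reaches (∈-map⁺ (stepLeft i) (∈-upTo⁺ (m%n<n d n)))
    where
      d = toℕ i + n ∸ toℕ j
      j≤i+n : toℕ j ≤ toℕ i + n
      j≤i+n = ≤-trans (<⇒≤ (toℕ<n j)) (m≤n+m n (toℕ i))
      reaches : stepLeft i (d % n) ≡ j
      reaches = %≡toℕ⇒mod≡ (begin
        (toℕ i + n ∸ d % n) % n                     ≡⟨ cong (λ m → (m ∸ d % n) % n) (m∸n+n≡m j≤i+n) ⟨
        (d + toℕ j ∸ d % n) % n                     ≡⟨ cong (λ m → (m + toℕ j ∸ d % n) % n) (m≡m%n+[m/n]*n d n) ⟩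
        (d % n + d / n * n + toℕ j ∸ d % n) % n     ≡⟨ cong (λ m → (m ∸ d % n) % n) (+-assoc (d % n) (d / n * n) (toℕ j)) ⟩
        (d % n + (d / n * n + toℕ j) ∸ d % n) % n   ≡⟨ cong (_% n) (m+n∸m≡n (d % n) (d / n * n + toℕ j)) ⟩
        (d / n * n + toℕ j) % n                     ≡⟨ cong (_% n) (+-comm (d / n * n) (toℕ j)) ⟩
        (toℕ j + d / n * n) % n                     ≡⟨ [m+kn]%n≡m%n (toℕ j) (d / n) n ⟩
        toℕ j % n                                   ≡⟨ m<n⇒m%n≡m (toℕ<n j) ⟩
        toℕ j                                       ∎)
        where open ≡-Reasoning

  leftScan : CyclicScan n
  leftScan = stepScan stepLeft stepLeft-zero stepLeft-period stepLeft-suc stepLeft-complete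

  rightScan : CyclicScan n
  rightScan = stepScan stepRight stepRight-zero stepRight-period (λ i t _ → stepRight-suc i t) stepRight-complete

module _ {n : ℕ} where

  _∖_ : (Fin n → Bool) → Fin n → Fin n → Bool
  (p ∖ j) k = p k ∧ not (does (k ≟ j))

  ∖-self : ∀ p j → (p ∖ j) j ≡ false
  ∖-self p j with j ≟ j
  ... | yes _   = ∧-zeroʳ (p j)
  ... | no j≢j = ⊥-elim (j≢j refl)

  ∖-other : ∀ p {j k} → k ≢ j → (p ∖ j) k ≡ p k
  ∖-other p {j} {k} k≢j with k ≟ j
  ... | yes k≡j = ⊥-elim (k≢j k≡j)
  ... | no _    = ∧-identityʳ (p k)

  ∖-false : ∀ {p : Fin n → Bool} {j k} → p k ≡ false → (p ∖ j) k ≡ false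
  ∖-false pk≡false rewrite pk≡false = refl

  countᵇ-∖-∉ : ∀ p {j} xs → j ∉ xs → countᵇ (p ∖ j) xs ≡ countᵇ p xs
  countᵇ-∖-∉ p []       j∉ = refl
  countᵇ-∖-∉ p (x ∷ xs) j∉ rewrite ∖-other p (λ x≡j → j∉ (here (sym x≡j))) | countᵇ-∖-∉ p xs (j∉ ∘ there) = refl

  countᵇ-∖ : ∀ p {j xs} → Unique xs → j ∈ xs → p j ≡ true → countᵇ p xs ≡ suc (countᵇ (p ∖ j) xs)
  countᵇ-∖ p {j} (x∉xs ∷ unique) (here refl) pj rewrite ∖-self p j | pj =
    cong suc (sym (countᵇ-∖-∉ p _ (λ j∈ → All.lookup x∉xs j∈ refl)))
  countᵇ-∖ p {j} {x ∷ xs} (x∉xs ∷ unique) (there j∈) pj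
    rewrite ∖-other p {j} {x} (λ x≡j → All.lookup x∉xs j∈ x≡j) | countᵇ-∖ p unique j∈ pj with p x
  ... | true  = refl
  ... | false = refl

countᵇ-lookup : ∀ {n} (q : Subset n) → countᵇ (lookup q) (allFin n) ≡ ∣ q ∣
countᵇ-lookup []          = refl
countᵇ-lookup (true ∷ q)  = cong suc (trans (countᵇ-tabulate (lookup (true ∷ q)) Fin.suc) (countᵇ-lookup q))
countᵇ-lookup (false ∷ q) = trans (countᵇ-tabulate (lookup (false ∷ q)) Fin.suc) (countᵇ-lookup q)

countᵇ-<ᵇ : ∀ {m n} → m ≤ n → countᵇ (λ k → toℕ k <ᵇ m) (allFin n) ≡ m
countᵇ-<ᵇ {zero}  {n}     _         = countᵇ-fails {xs = allFin n} (All.tabulate (λ _ → refl))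
countᵇ-<ᵇ {suc m} {suc n} (s≤s m≤n) =
  cong suc (trans (countᵇ-tabulate {n = n} (λ k → toℕ k <ᵇ suc m) Fin.suc) (countᵇ-<ᵇ m≤n))

module _ {n : ℕ} where

  setAt-cong : ∀ {v w : Partial n} j x → v ≗ w → setAt v j x ≗ setAt w j x
  setAt-cong j x v≗w k with k ≟ j
  ... | yes _ = refl
  ... | no _  = v≗w k

  setAt-comm : ∀ (v : Partial n) {j k} x y → j ≢ k → setAt (setAt v j x) k y ≗ setAt (setAt v k y) j x
  setAt-comm v {j} {k} x y j≢k i with i ≟ k | i ≟ j
  ... | yes refl | yes refl = ⊥-elim (j≢k refl)
  ... | yes _    | no _     = refl
  ... | no _     | yes _    = refl
  ... | no _     | no _     = refl

module _ {n : ℕ} (S : CyclicScan n) where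

  open CyclicScan S

  scan-restart : ∀ {p} i {j} → firstSuch p (scan i) ≡ just j → firstSuch (p ∖ j) (scan i) ≡ firstSuch (p ∖ j) (scan j)
  scan-restart {p} i {j} first≡j with xs , ys , split , fails ← firstSuch-split (scan i) first≡j = begin
    firstSuch (p ∖ j) (scan i)          ≡⟨ cong (firstSuch (p ∖ j)) split ⟩
    firstSuch (p ∖ j) (xs ++ j ∷ ys)    ≡⟨ firstSuch-++-skip fails∖j (j ∷ ys) ⟩
    firstSuch (p ∖ j) (j ∷ ys)          ≡⟨ firstSuch-++-fails (j ∷ ys) fails∖j ⟨
    firstSuch (p ∖ j) (j ∷ ys ++ xs)    ≡⟨ cong (firstSuch (p ∖ j)) (scan-rotate i split) ⟨
    firstSuch (p ∖ j) (scan j)          ∎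
    where
      open ≡-Reasoning
      fails∖j : Fails (p ∖ j) xs
      fails∖j = All.map (∖-false {p = p}) fails

  module Filling (eligible : Fin n → Bool) where

    free : Partial n → Fin n → Bool
    free v j = eligible j ∧ is-nothing (v j)

    fill : Partial n → ℕ → Maybe (Fin n) → Partial n
    fill v x (just j) = setAt v j x
    fill v x nothing  = v

    place : Partial n → ℕ → Fin n → Partial n
    place v x i = fill v x (firstSuch (free v) (scan i))

    free-setAt : ∀ v j x → free (setAt v j x) ≗ free v ∖ j
    free-setAt v j x k with k ≟ j
    ... | yes _ = trans (∧-zeroʳ (eligible k)) (sym (∧-zeroʳ _))
    ... | no _  = sym (∧-identityʳ _)

    free-cong : ∀ {v w} → v ≗ w → free v ≗ free w
    free-cong v≗w k = cong (λ m → eligible k ∧ is-nothing m) (v≗w k)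

    place-cong : ∀ {v w} x i → v ≗ w → place v x i ≗ place w x i
    place-cong {v} {w} x i v≗w k rewrite firstSuch-cong (free-cong v≗w) (scan i) with firstSuch (free w) (scan i)
    ... | just j  = setAt-cong j x v≗w k
    ... | nothing = v≗w k

    place-just : ∀ {v i j} x → firstSuch (free v) (scan i) ≡ just j → place v x i ≡ setAt v j x
    place-just {v} x first≡j = cong (fill v x) first≡j

    place-nothing : ∀ {v i} x → firstSuch (free v) (scan i) ≡ nothing → place v x i ≡ v
    place-nothing {v} x first≡nothing = cong (fill v x) first≡nothing

    place-place : ∀ {v a b ja jb} x → firstSuch (free v) (scan a) ≡ just ja →
                  firstSuch (free (setAt v ja x)) (scan b) ≡ just jb → place (place v x a) x b ≡ setAt (setAt v ja x) jb x
    place-place {b = b} x first≡ja first≡jb = trans (cong (λ w → place w x b) (place-just x first≡ja)) (place-just x first≡jb)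

    place-setAt-restart : ∀ {v i j} x → firstSuch (free v) (scan i) ≡ just j →
                          place (setAt v j x) x i ≡ fill (setAt v j x) x (firstSuch (free v ∖ j) (scan j))
    place-setAt-restart {v} {i} {j} x first≡j =
      cong (fill (setAt v j x) x) (trans (firstSuch-cong (free-setAt v j x) (scan i)) (scan-restart i first≡j))

    firstSuch-free-setAt : ∀ {v i j j′} x → j′ ≢ j → firstSuch (free v) (scan i) ≡ just j →
                           firstSuch (free (setAt v j′ x)) (scan i) ≡ just j
    firstSuch-free-setAt {v} {i} {j} {j′} x j′≢j first≡j = trans (firstSuch-cong (free-setAt v j′ x) (scan i))
      (firstSuch-restrict (scan i) first≡j (∖-false {p = free v})
        (trans (∖-other (free v) (j′≢j ∘ sym)) (firstSuch-just⇒true (scan i) first≡j)))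

    place-comm : ∀ v x a b → place (place v x a) x b ≗ place (place v x b) x a
    place-comm v x a b = by-cases refl refl
      where
        by-cases : ∀ {ma mb} → firstSuch (free v) (scan a) ≡ ma → firstSuch (free v) (scan b) ≡ mb →
                   place (place v x a) x b ≗ place (place v x b) x a
        by-cases {nothing} {nothing} ea eb = cong-app (begin
            place (place v x a) x b  ≡⟨ cong (λ w → place w x b) (place-nothing x ea) ⟩
            place v x b              ≡⟨ place-nothing x eb ⟩
            v                        ≡⟨ place-nothing x ea ⟨
            place v x a              ≡⟨ cong (λ w → place w x a) (place-nothing x eb) ⟨
            place (place v x b) x a  ∎)
          where open ≡-Reasoning
        by-cases {nothing} {just jb} ea eb
          with () ← trans (sym (firstSuch-just⇒true (scan b) eb)) (firstSuch-nothing⇒false ea (scan-complete a jb))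
        by-cases {just ja} {nothing} ea eb
          with () ← trans (sym (firstSuch-just⇒true (scan a) ea)) (firstSuch-nothing⇒false eb (scan-complete b ja))
        by-cases {just ja} {just jb} ea eb with ja ≟ jb
        ... | yes refl = cong-app (begin
            place (place v x a) x b                                    ≡⟨ cong (λ w → place w x b) (place-just x ea) ⟩
            place (setAt v ja x) x b                                   ≡⟨ place-setAt-restart x eb ⟩
            fill (setAt v ja x) x (firstSuch (free v ∖ ja) (scan ja))  ≡⟨ place-setAt-restart x ea ⟨
            place (setAt v ja x) x a                                   ≡⟨ cong (λ w → place w x a) (place-just x eb) ⟨
            place (place v x b) x a                                    ∎)
          where open ≡-Reasoning
        ... | no ja≢jb = λ k → begin
            place (place v x a) x b k    ≡⟨ cong-app (place-place x ea (firstSuch-free-setAt x ja≢jb eb)) k ⟩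
            setAt (setAt v ja x) jb x k  ≡⟨ setAt-comm v x x ja≢jb k ⟩
            setAt (setAt v jb x) ja x k  ≡⟨ cong-app (place-place x eb (firstSuch-free-setAt x (ja≢jb ∘ sym) ea)) k ⟨
            place (place v x b) x a k    ∎
          where open ≡-Reasoning

    place-ineligible : ∀ v x i {k} → eligible k ≡ false → place v x i k ≡ v k
    place-ineligible v x i {k} ineligible with firstSuch (free v) (scan i) in first≡
    ... | nothing = refl
    ... | just j with k ≟ j
    ...   | no _     = refl
    ...   | yes refl with () ← trans (sym (firstSuch-just⇒true (scan i) first≡)) (cong (_∧ is-nothing (v k)) ineligible)

    nFree : Partial n → ℕ
    nFree v = countᵇ (free v) (allFin n)

    nFree-setAt : ∀ {v i j} x → firstSuch (free v) (scan i) ≡ just j → nFree v ≡ suc (nFree (setAt v j x))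
    nFree-setAt {v} {i} {j} x first≡j =
      trans (countᵇ-∖ (free v) (Unique.allFin⁺ n) (∈-allFin j) (firstSuch-just⇒true (scan i) first≡j))
            (cong suc (sym (countᵇ-cong (free-setAt v j x) (allFin n))))

    nFree-nothing : ∀ {v i} → firstSuch (free v) (scan i) ≡ nothing → nFree v ≡ 0
    nFree-nothing {v} {i} first≡nothing =
      countᵇ-fails {p = free v} {allFin n} (All.tabulate (λ {k} _ → firstSuch-nothing⇒false first≡nothing (scan-complete i k)))

    place-nFree : ∀ {v m} x i → nFree v ≡ suc m → nFree (place v x i) ≡ m
    place-nFree {v} x i nFree≡ with firstSuch (free v) (scan i) in first≡
    ... | just j  = suc-injective (trans (sym (nFree-setAt x first≡)) nFree≡)
    ... | nothing with () ← trans (sym nFree≡) (nFree-nothing first≡)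

    place-full : ∀ {v} x i → nFree v ≡ 0 → place v x i ≡ v
    place-full {v} x i nFree≡0 with firstSuch (free v) (scan i) in first≡
    ... | nothing = refl
    ... | just j with () ← trans (sym nFree≡0) (nFree-setAt x first≡)

    module _ (val : Fin n → ℕ) where

      placeBy : Partial n → Fin n → Partial n
      placeBy v i = place v (val i) i

      placeBy-swap : ∀ {a b} → val a ≡ val b → ∀ v → placeBy (placeBy v a) b ≗ placeBy (placeBy v b) a
      placeBy-swap {a} {b} val≡ v rewrite val≡ = place-comm v (val b) a b

      foldl-placeBy-full : ∀ is {v} → nFree v ≡ 0 → foldl placeBy v is ≡ v
      foldl-placeBy-full []       full = refl
      foldl-placeBy-full (i ∷ is) full rewrite place-full (val i) i full = foldl-placeBy-full is full

      foldl-placeBy-exhausts : ∀ is js {v} → nFree v ≡ length is → foldl placeBy v (is ++ js) ≡ foldl placeBy v is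
      foldl-placeBy-exhausts []       js nFree≡ = foldl-placeBy-full js nFree≡
      foldl-placeBy-exhausts (i ∷ is) js nFree≡ = foldl-placeBy-exhausts is js (place-nFree (val i) i nFree≡)

      foldl-placeBy-ineligible : ∀ is {v k} → eligible k ≡ false → foldl placeBy v is k ≡ v k
      foldl-placeBy-ineligible []       ineligible = refl
      foldl-placeBy-ineligible (i ∷ is) {v} ineligible =
        trans (foldl-placeBy-ineligible is ineligible) (place-ineligible v (val i) i ineligible)

module QueueAlgorithm {n : ℕ} .{{_ : NonZero n}} (q : Subset n) (u : Word n) where

  module I  = Filling leftScan  (not ∘ lookup q)
  module II = Filling rightScan (lookup q)

  stepI : Partial n → Fin n → Partial n
  stepI = I.placeBy (suc ∘ u)

  stepII : Partial n → Fin n → Partial n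
  stepII = II.placeBy u

  phaseIStep≡stepI : ∀ v i → phaseIStep q u v i ≡ stepI v i
  phaseIStep≡stepI v i with firstSuch (λ j → not (lookup q j) ∧ is-nothing (v j)) (map (stepLeft i) (upTo n))
  ... | just _  = refl
  ... | nothing = refl

  phaseIIStep≡stepII : ∀ v i → phaseIIStep q u v i ≡ stepII v i
  phaseIIStep≡stepII v i with firstSuch (λ j → lookup q j ∧ is-nothing (v j)) (map (stepRight i) (upTo n))
  ... | just _  = refl
  ... | nothing = refl

  empty : Partial n
  empty _ = nothing

  lowRanks highRanks : List (Fin n)
  lowRanks  = filter (λ k → toℕ k <? ∣ q ∣) (allFin n)
  highRanks = filter (λ k → ∣ q ∣ ≤? toℕ k) (allFin n)

  lowRanks++highRanks : lowRanks ++ highRanks ≡ allFin n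
  lowRanks++highRanks = filter-++-filter (λ k → toℕ k <? ∣ q ∣) (λ k → ∣ q ∣ ≤? toℕ k) <⇒≱ ≮⇒≥
                          (AllPairs.tabulate⁺-< (λ i<j j<m → <-trans i<j j<m))

  length-lowRanks : length lowRanks ≡ ∣ q ∣
  length-lowRanks = trans (length-filter≡countᵇ (λ k → toℕ k <? ∣ q ∣) (allFin n)) (countᵇ-<ᵇ (∣p∣≤n q))

  length-highRanks : length highRanks ≡ n ∸ ∣ q ∣
  length-highRanks = begin
    length highRanks                                        ≡⟨ m+n∸m≡n (length lowRanks) (length highRanks) ⟨
    length lowRanks + length highRanks ∸ length lowRanks    ≡⟨ cong₂ _∸_ total length-lowRanks ⟩
    n ∸ ∣ q ∣                                               ∎
    where
      open ≡-Reasoning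
      total : length lowRanks + length highRanks ≡ n
      total = trans (sym (length-++ lowRanks)) (trans (cong length lowRanks++highRanks) (length-tabulate (λ k → k)))

  I-nFree-empty : I.nFree empty ≡ n ∸ ∣ q ∣
  I-nFree-empty = begin
    I.nFree empty                      ≡⟨ countᵇ-cong (λ k → trans (∧-identityʳ _) (sym (lookup-map k not q))) (allFin n) ⟩
    countᵇ (lookup (∁ q)) (allFin n)   ≡⟨ countᵇ-lookup (∁ q) ⟩
    ∣ ∁ q ∣                            ≡⟨ ∣∁p∣≡n∸∣p∣ q ⟩
    n ∸ ∣ q ∣                          ∎
    where open ≡-Reasoning

  II-nFree-after-phaseI : ∀ is → II.nFree (foldl stepI empty is) ≡ ∣ q ∣
  II-nFree-after-phaseI is = trans (countᵇ-cong queue-sites-free (allFin n)) (countᵇ-lookup q)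
    where
      queue-sites-free : ∀ k → lookup q k ∧ is-nothing (foldl stepI empty is k) ≡ lookup q k
      queue-sites-free k with lookup q k in qk
      ... | false = refl
      ... | true rewrite I.foldl-placeBy-ineligible (suc ∘ u) is {empty} {k} (cong not qk) = refl

  order : Permutation′ n → List (Fin n)
  order σ = map (σ ⟨$⟩ʳ_) (allFin n)

  module _ (σ : Permutation′ n) where

    private
      s : Fin n → Fin n
      s = σ ⟨$⟩ʳ_

    queueAlg≡phases : queueAlg q u σ ≡ foldl stepII (foldl stepI empty (map s (reverse highRanks))) (map s lowRanks)
    queueAlg≡phases = begin
      queueAlg q u σ
        ≡⟨ cong (λ v → foldl (λ w k → phaseIIStep q u w (s k)) v lowRanks)
                (foldl-cong (λ v k → phaseIStep≡stepI v (s k)) empty (reverse highRanks)) ⟩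
      foldl (λ w k → phaseIIStep q u w (s k)) (foldl (λ v k → stepI v (s k)) empty (reverse highRanks)) lowRanks
        ≡⟨ foldl-cong (λ v k → phaseIIStep≡stepII v (s k)) _ lowRanks ⟩
      foldl (λ w k → stepII w (s k)) (foldl (λ v k → stepI v (s k)) empty (reverse highRanks)) lowRanks
        ≡⟨ foldl-map stepII s _ lowRanks ⟨
      foldl stepII (foldl (λ v k → stepI v (s k)) empty (reverse highRanks)) (map s lowRanks)
        ≡⟨ cong (λ v → foldl stepII v (map s lowRanks)) (foldl-map stepI s empty (reverse highRanks)) ⟨
      foldl stepII (foldl stepI empty (map s (reverse highRanks))) (map s lowRanks)
        ∎
      where open ≡-Reasoning

    phaseI-extends : foldl stepI empty (reverse (order σ)) ≡ foldl stepI empty (map s (reverse highRanks))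
    phaseI-extends = begin
      foldl stepI empty (reverse (order σ))
        ≡⟨ cong (foldl stepI empty) reversed ⟩
      foldl stepI empty (map s (reverse highRanks) ++ map s (reverse lowRanks))
        ≡⟨ I.foldl-placeBy-exhausts (suc ∘ u) (map s (reverse highRanks)) (map s (reverse lowRanks)) nFree≡ ⟩
      foldl stepI empty (map s (reverse highRanks))
        ∎
      where
        open ≡-Reasoning
        reversed : reverse (order σ) ≡ map s (reverse highRanks) ++ map s (reverse lowRanks)
        reversed = begin
          reverse (map s (allFin n))                           ≡⟨ reverse-map s (allFin n) ⟨
          map s (reverse (allFin n))                           ≡⟨ cong (map s ∘ reverse) lowRanks++highRanks ⟨
          map s (reverse (lowRanks ++ highRanks))              ≡⟨ cong (map s) (reverse-++ lowRanks highRanks) ⟩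
          map s (reverse highRanks ++ reverse lowRanks)        ≡⟨ map-++ s (reverse highRanks) (reverse lowRanks) ⟩
          map s (reverse highRanks) ++ map s (reverse lowRanks) ∎
        nFree≡ : I.nFree empty ≡ length (map s (reverse highRanks))
        nFree≡ = trans I-nFree-empty
                   (sym (trans (length-map s (reverse highRanks)) (trans (length-reverse highRanks) length-highRanks)))

    phaseII-extends : ∀ v → II.nFree v ≡ ∣ q ∣ → foldl stepII v (order σ) ≡ foldl stepII v (map s lowRanks)
    phaseII-extends v nFree≡ = begin
      foldl stepII v (order σ)                              ≡⟨ cong (foldl stepII v ∘ map s) lowRanks++highRanks ⟨
      foldl stepII v (map s (lowRanks ++ highRanks))        ≡⟨ cong (foldl stepII v) (map-++ s lowRanks highRanks) ⟩
      foldl stepII v (map s lowRanks ++ map s highRanks)    ≡⟨ II.foldl-placeBy-exhausts u (map s lowRanks) (map s highRanks) nFree≡′ ⟩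
      foldl stepII v (map s lowRanks)                       ∎
      where
        open ≡-Reasoning
        nFree≡′ : II.nFree v ≡ length (map s lowRanks)
        nFree≡′ = trans nFree≡ (sym (trans (length-map s lowRanks) length-lowRanks))

    queueAlg≡phases-over-order : queueAlg q u σ ≡ foldl stepII (foldl stepI empty (reverse (order σ))) (order σ)
    queueAlg≡phases-over-order = begin
      queueAlg q u σ
        ≡⟨ queueAlg≡phases ⟩
      foldl stepII (foldl stepI empty (map s (reverse highRanks))) (map s lowRanks)
        ≡⟨ phaseII-extends _ (II-nFree-after-phaseI (map s (reverse highRanks))) ⟨
      foldl stepII (foldl stepI empty (map s (reverse highRanks))) (order σ)
        ≡⟨ cong (λ v → foldl stepII v (order σ)) phaseI-extends ⟨
      foldl stepII (foldl stepI empty (reverse (order σ))) (order σ)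
        ∎
      where open ≡-Reasoning

  order-sorted : ∀ σ → SortsWord u σ → AllPairs (λ a b → u a ≤ u b) (order σ)
  order-sorted σ σ-sorted = AllPairs.map⁺ (AllPairs.tabulate⁺-< (λ i<j → σ-sorted _ _ (<⇒≤ i<j)))

  order-unique : ∀ σ → Unique (order σ)
  order-unique σ = Unique.map⁺ σ-injective (Unique.allFin⁺ n)
    where
      σ-injective : ∀ {i j} → σ ⟨$⟩ʳ i ≡ σ ⟨$⟩ʳ j → i ≡ j
      σ-injective eq = trans (sym (inverseˡ σ)) (trans (cong (σ ⟨$⟩ˡ_) eq) (inverseˡ σ))

  order-complete : ∀ σ j → j ∈ order σ
  order-complete σ j = subst (_∈ order σ) (inverseʳ σ) (∈-map⁺ (σ ⟨$⟩ʳ_) (∈-allFin (σ ⟨$⟩ˡ j)))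

  order-↭ : ∀ σ τ → order σ ↭ order τ
  order-↭ σ τ = unique-↭ (order-unique σ) (order-unique τ) (λ _ → order-complete τ _) (λ _ → order-complete σ _)

  foldl-stepI-↭ : ∀ {is js} v → is ↭ js → AllPairs (λ a b → u b ≤ u a) is → AllPairs (λ a b → u b ≤ u a) js →
                  foldl stepI v is ≗ foldl stepI v js
  foldl-stepI-↭ = foldl-↭-sorted (Fin n →-setoid Maybe ℕ) stepI (λ i → I.place-cong _ i)
                    (λ ub≤ua ua≤ub → I.placeBy-swap (suc ∘ u) (cong suc (≤-antisym ua≤ub ub≤ua)))

  foldl-stepII-↭ : ∀ {is js} v → is ↭ js → AllPairs (λ a b → u a ≤ u b) is → AllPairs (λ a b → u a ≤ u b) js →
                   foldl stepII v is ≗ foldl stepII v js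
  foldl-stepII-↭ = foldl-↭-sorted (Fin n →-setoid Maybe ℕ) stepII (λ i → II.place-cong _ i)
                     (λ ua≤ub ub≤ua → II.placeBy-swap u (≤-antisym ua≤ub ub≤ua))

  foldl-stepII-congˡ : ∀ is {v w} → v ≗ w → foldl stepII v is ≗ foldl stepII w is
  foldl-stepII-congˡ = foldl-congˡ (Fin n →-setoid Maybe ℕ) stepII (λ i → II.place-cong _ i)

lemma2p3 : (n : ℕ) .{{_ : NonZero n}} (q : Subset n) (u : Word n)
           → (∀ i → 1 ≤ u i)
           → (σ τ : Permutation′ n) → SortsWord u σ → SortsWord u τ
           → ∀ j → queueAlg q u σ j ≡ queueAlg q u τ j
lemma2p3 n q u _ σ τ σ-sorted τ-sorted j = begin
  queueAlg q u σ j                                                   ≡⟨ cong-app (queueAlg≡phases-over-order σ) j ⟩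
  foldl stepII (foldl stepI empty (reverse (order σ))) (order σ) j   ≡⟨ foldl-stepII-congˡ (order σ) phaseI j ⟩
  foldl stepII (foldl stepI empty (reverse (order τ))) (order σ) j   ≡⟨ phaseII j ⟩
  foldl stepII (foldl stepI empty (reverse (order τ))) (order τ) j   ≡⟨ cong-app (queueAlg≡phases-over-order τ) j ⟨
  queueAlg q u τ j                                                   ∎
  where
    open ≡-Reasoning
    open QueueAlgorithm q u renaming (order-sorted to sorted)
    phaseII : ∀ {v} → foldl stepII v (order σ) ≗ foldl stepII v (order τ)
    phaseII = foldl-stepII-↭ _ (order-↭ σ τ) (sorted σ σ-sorted) (sorted τ τ-sorted)
    phaseI : foldl stepI empty (reverse (order σ)) ≗ foldl stepI empty (reverse (order τ))
    phaseI = foldl-stepI-↭ empty (↭-trans (↭-reverse (order σ)) (↭-trans (order-↭ σ τ) (↭-sym (↭-reverse (order τ)))))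
               (AllPairs-reverse (sorted σ σ-sorted)) (AllPairs-reverse (sorted τ τ-sorted))
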